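{- As formal power series in $x$ with coefficients that are polynomials in $q$, \[\prod_{n=1}^{\infty}\frac{1}{1-q^{\binom{n+1}{2}}x^n}-1=\sum_{n=1}^{\infty}\sum_{\lambda\vdash n}q^{\left(\binom{n+1}{2}-g(\lambda)\right)}x^n.\]
   Context: $\lambda\vdash n$ means $\lambda$ is a partition of $n$, i.e. a non-increasing sequence of positive integers summing to $n$; it is padded with zeros to length $n$: $\lambda=(\lambda_1,\ldots,\lambda_n)$. The Gini index of $\lambda$ is $g(\lambda)=\binom{n+1}{2}-\sum_{i=1}^n i\,\lambda_i$. -}

module Defs where

open import Data.Nat using (ℕ; zero; suc; _≤_; _≥_; _∸_; _≟_) renaming (_+_ to _+ℕ_; _*_ to _*ℕ_)
open import Data.Nat.Combinatorics using (_C_)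
open import Data.Integer using (ℤ; +_; _+_; _*_; _-_)
open import Data.List using (List; []; _∷_)
open import Data.Nat.ListAction using (sum)
open import Relation.Binary.PropositionalEquality using (_≡_)
open import Data.List.Relation.Unary.All using (All)
open import Data.List.Relation.Unary.Linked using (Linked)
open import Data.Bool using (if_then_else_; _∧_)
open import Data.Product using (_×_)
open import Relation.Nullary.Decidable using (⌊_⌋)
import Data.Integer.Properties as ℤP

-- Bivariate formal power series: f n k = coefficient of x^n q^k (integer coefficients).
Series : Set
Series = ℕ → ℕ → ℤ

sumTo : ℕ → (ℕ → ℤ) → ℤ
sumTo zero f = f zero
sumTo (suc n) f = sumTo n f + f (suc n)

_⊛_ : Series → Series → Series
(f ⊛ g) n k = sumTo n (λ i → sumTo k (λ j → f i j * g (n ∸ i) (k ∸ j)))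

one : Series
one zero zero = + 1
one _ _ = + 0

-- 1/(1 - q^a x^m) = Σ_{j≥0} (q^a x^m)^j, for m ≥ 1 (terms with j > n have
-- x-degree > n, so the coefficient of x^n is a finite sum over j ≤ n).
geom : ℕ → ℕ → Series
geom a m n k = sumTo n (λ j → if ⌊ m *ℕ j ≟ n ⌋ ∧ ⌊ a *ℕ j ≟ k ⌋ then + 1 else + 0)

tri : ℕ → ℕ
tri m = suc m C 2

factor : ℕ → Series
factor m = geom (tri m) m

finProd : ℕ → Series
finProd zero = one
finProd (suc M) = finProd M ⊛ factor (suc M)

-- Partitions of n: lists of positive parts, non-increasing, summing to n
-- (the padding zeros are omitted).
IsPartition : ℕ → List ℕ → Set
IsPartition n λs = All (λ p → 1 ≤ p) λs × Linked _≥_ λs × sum λs ≡ n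

-- Σ_{i≥1} i λ_i, with λ_1 the head (zeros contribute nothing)
weightFrom : ℕ → List ℕ → ℕ
weightFrom i [] = 0
weightFrom i (p ∷ ps) = i *ℕ p +ℕ weightFrom (suc i) ps

gini : ℕ → List ℕ → ℤ
gini n λs = + tri n - + weightFrom 1 λs

-- coefficient of x^n q^k in Σ_{n≥1} Σ_{λ⊢n} q^{binom(n+1,2) - g(λ)} x^n,
-- where the sum over λ ⊢ n is taken over a duplicate-free list L enumerating them
rhsCoeff : ℕ → ℕ → List (List ℕ) → ℤ
rhsCoeff zero k L = + 0
rhsCoeff (suc n) k [] = + 0
rhsCoeff (suc n) k (λs ∷ L) =
  (if ⌊ + k ℤP.≟ (+ tri (suc n) - gini (suc n) λs) ⌋ then + 1 else + 0) + rhsCoeff (suc n) k L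

module Submission where

-- Expanding the product, the coefficient of x^n q^k in ∏_{m ≤ M} 1/(1 - q^{binom(m+1,2)} x^m)
-- counts the vectors (d₁, …, d_M) with Σ m d_m = n and Σ binom(m+1,2) d_m = k. Reading d_m as the
-- number of columns of length m of a Young diagram, the rows μ_j = d_j + ⋯ + d_M form a partition
-- of n with at most M parts, every such partition arises exactly once, and Σ j μ_j = Σ binom(m+1,2) d_m.
-- So once M ≥ n the coefficient counts the partitions μ ⊢ n with Σ j μ_j = k, which is what the
-- right-hand side counts, since binom(n+1,2) - g(μ) = Σ j μ_j.

open import Defs
open import Data.Bool using (Bool; true; false; if_then_else_; _∧_)
open import Data.Empty using (⊥-elim)
open import Data.Integer using (ℤ; +_; _+_; _*_; _-_)
import Data.Integer.Properties as ℤP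
import Data.Integer.Tactic.RingSolver as ℤSolver
open import Algebra.Properties.CommutativeSemigroup ℤP.+-commutativeSemigroup using (interchange)
open import Data.List using (List; []; _∷_; [_]; _++_; _∷ʳ_; map; foldr; drop; length; initLast; _∷ʳ′_)
import Data.List.Properties as List
open import Data.List.Membership.Propositional using (_∈_)
open import Data.List.Membership.Propositional.Properties using (∈-map⁺; ∈-map⁻; ∈-++⁺ˡ; ∈-++⁺ʳ; ∈-++⁻)
open import Data.List.Membership.Propositional.Properties.WithK using (unique∧set⇒bag)
open import Data.List.Relation.Binary.BagAndSetEquality using (∼bag⇒↭)
open import Data.List.Relation.Binary.Permutation.Propositional using (_↭_; prep; swap)
import Data.List.Relation.Binary.Permutation.Propositional as ↭
open import Data.List.Relation.Unary.All as All using (All; []; _∷_)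
open import Data.List.Relation.Unary.Any using (here; there)
open import Data.List.Relation.Unary.Linked as Linked using (Linked; []; [-]; _∷_)
open import Data.List.Relation.Unary.Unique.Propositional using (Unique)
import Data.List.Relation.Unary.Unique.Propositional.Properties as Unique
open import Data.List.Relation.Unary.AllPairs using ([]; _∷_)
open import Data.Nat using (ℕ; zero; suc; _≤_; _<_; _≥_; _≟_; _≤?_; z≤n; s≤s; _∸_)
  renaming (_+_ to _+ℕ_; _*_ to _*ℕ_)
import Data.Nat.Properties as ℕP
open import Data.Nat.Tactic.RingSolver using (solve-∀)
open import Data.Nat.Combinatorics using (nCk+nC[k+1]≡[n+1]C[k+1]; nC1≡n)
open import Data.Nat.ListAction using (sum)
open import Data.Product using (∃; _×_; _,_; proj₁; proj₂)
open import Data.Sum using (inj₁; inj₂)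
open import Function using (id; _∘_)
open import Function.Bundles using (_⇔_; mk⇔; Equivalence)
open import Relation.Nullary using (¬_; Dec; yes; no)
open import Relation.Nullary.Decidable using (⌊_⌋)
open import Relation.Binary.PropositionalEquality
  using (_≡_; _≢_; refl; sym; trans; cong; cong₂; subst; module ≡-Reasoning)
open ≡-Reasoning

sumTo-cong : ∀ n {f g : ℕ → ℤ} → (∀ i → i ≤ n → f i ≡ g i) → sumTo n f ≡ sumTo n g
sumTo-cong zero f≡g = f≡g 0 z≤n
sumTo-cong (suc n) f≡g =
  cong₂ _+_ (sumTo-cong n (λ i i≤n → f≡g i (ℕP.m≤n⇒m≤1+n i≤n))) (f≡g (suc n) ℕP.≤-refl)

sumTo-zero : ∀ n {f : ℕ → ℤ} → (∀ i → i ≤ n → f i ≡ + 0) → sumTo n f ≡ + 0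
sumTo-zero zero f≡0 = f≡0 0 z≤n
sumTo-zero (suc n) f≡0 =
  cong₂ _+_ (sumTo-zero n (λ i i≤n → f≡0 i (ℕP.m≤n⇒m≤1+n i≤n))) (f≡0 (suc n) ℕP.≤-refl)

sumTo-+ : ∀ n (f g : ℕ → ℤ) → sumTo n (λ i → f i + g i) ≡ sumTo n f + sumTo n g
sumTo-+ zero f g = refl
sumTo-+ (suc n) f g = trans (cong (_+ (f (suc n) + g (suc n))) (sumTo-+ n f g))
  (interchange (sumTo n f) (sumTo n g) (f (suc n)) (g (suc n)))

sumTo-*ˡ : ∀ n (c : ℤ) (f : ℕ → ℤ) → c * sumTo n f ≡ sumTo n (λ i → c * f i)
sumTo-*ˡ zero c f = refl
sumTo-*ˡ (suc n) c f =
  trans (ℤP.*-distribˡ-+ c (sumTo n f) (f (suc n))) (cong (_+ c * f (suc n)) (sumTo-*ˡ n c f))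

sumTo-*ʳ : ∀ n (c : ℤ) (f : ℕ → ℤ) → sumTo n f * c ≡ sumTo n (λ i → f i * c)
sumTo-*ʳ n c f = begin
  sumTo n f * c            ≡⟨ ℤP.*-comm (sumTo n f) c ⟩
  c * sumTo n f            ≡⟨ sumTo-*ˡ n c f ⟩
  sumTo n (λ i → c * f i)  ≡⟨ sumTo-cong n (λ i _ → ℤP.*-comm c (f i)) ⟩
  sumTo n (λ i → f i * c)  ∎

sumTo-comm : ∀ n m (f : ℕ → ℕ → ℤ) →
  sumTo n (λ i → sumTo m (f i)) ≡ sumTo m (λ j → sumTo n (λ i → f i j))
sumTo-comm zero m f = refl
sumTo-comm (suc n) m f = trans (cong (_+ sumTo m (f (suc n))) (sumTo-comm n m f))
  (sym (sumTo-+ m (λ j → sumTo n (λ i → f i j)) (f (suc n))))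

sumTo-extend : ∀ {n} N (f : ℕ → ℤ) → n ≤ N → (∀ j → n < j → j ≤ N → f j ≡ + 0) →
  sumTo n f ≡ sumTo N f
sumTo-extend zero f z≤n _ = refl
sumTo-extend {n} (suc N) f n≤1+N tail≡0 with n ≤? N
... | yes n≤N = begin
  sumTo n f             ≡⟨ sumTo-extend N f n≤N (λ j n<j j≤N → tail≡0 j n<j (ℕP.m≤n⇒m≤1+n j≤N)) ⟩
  sumTo N f             ≡⟨ sym (ℤP.+-identityʳ (sumTo N f)) ⟩
  sumTo N f + + 0       ≡⟨ cong (λ z → sumTo N f + z) (sym (tail≡0 (suc N) (s≤s n≤N) ℕP.≤-refl)) ⟩
  sumTo (suc N) f       ∎
... | no n≰N rewrite ℕP.≤-antisym n≤1+N (ℕP.≰⇒> n≰N) = refl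

sumTo-single : ∀ n c (f : ℕ → ℤ) → c ≤ n → (∀ i → i ≤ n → i ≢ c → f i ≡ + 0) → sumTo n f ≡ f c
sumTo-single zero .zero f z≤n _ = refl
sumTo-single (suc n) c f c≤1+n others≡0 with c ≤? n
... | yes c≤n = begin
  sumTo n f + f (suc n) ≡⟨ cong₂ _+_ (sumTo-single n c f c≤n (λ i i≤n → others≡0 i (ℕP.m≤n⇒m≤1+n i≤n)))
                                    (others≡0 (suc n) ℕP.≤-refl
                                      (λ 1+n≡c → ℕP.<-irrefl (sym 1+n≡c) (s≤s c≤n))) ⟩
  f c + + 0             ≡⟨ ℤP.+-identityʳ (f c) ⟩
  f c                   ∎
... | no c≰n rewrite ℕP.≤-antisym c≤1+n (ℕP.≰⇒> c≰n) = begin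
  sumTo n f + f (suc n) ≡⟨ cong (_+ f (suc n)) (sumTo-zero n (λ i i≤n →
                             others≡0 i (ℕP.m≤n⇒m≤1+n i≤n) (λ i≡1+n → ℕP.<-irrefl i≡1+n (s≤s i≤n)))) ⟩
  + 0 + f (suc n)       ≡⟨ ℤP.+-identityˡ (f (suc n)) ⟩
  f (suc n)             ∎

𝟙 : Bool → ℤ
𝟙 b = if b then + 1 else + 0

when : Bool → ℤ → ℤ
when b x = if b then x else + 0

isYes-true : ∀ {a} {A : Set a} (a? : Dec A) → A → ⌊ a? ⌋ ≡ true
isYes-true (yes _) _ = refl
isYes-true (no ¬a) a = ⊥-elim (¬a a)

isYes-false : ∀ {a} {A : Set a} (a? : Dec A) → ¬ A → ⌊ a? ⌋ ≡ false
isYes-false (yes a) ¬a = ⊥-elim (¬a a)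
isYes-false (no _) _ = refl

isYes-⇔ : ∀ {a b} {A : Set a} {B : Set b} (a? : Dec A) (b? : Dec B) → (A → B) → (B → A) → ⌊ a? ⌋ ≡ ⌊ b? ⌋
isYes-⇔ (yes _) (yes _) _ _ = refl
isYes-⇔ (no _) (no _) _ _ = refl
isYes-⇔ (yes a) (no ¬b) A→B _ = ⊥-elim (¬b (A→B a))
isYes-⇔ (no ¬a) (yes b) _ B→A = ⊥-elim (¬a (B→A b))

+-≟-split : ∀ w c k → ⌊ w +ℕ c ≟ k ⌋ ≡ ⌊ c ≤? k ⌋ ∧ ⌊ w ≟ k ∸ c ⌋
+-≟-split w c k with c ≤? k
... | yes c≤k = isYes-⇔ (w +ℕ c ≟ k) (w ≟ k ∸ c)
  (λ w+c≡k → trans (sym (ℕP.m+n∸n≡m w c)) (cong (_∸ c) w+c≡k))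
  (λ w≡k∸c → trans (cong (_+ℕ c) w≡k∸c) (ℕP.m∸n+n≡m c≤k))
... | no c≰k = isYes-false (w +ℕ c ≟ k) (λ w+c≡k → c≰k (subst (c ≤_) w+c≡k (ℕP.m≤n+m c w)))

𝟙-∧ : ∀ (z : ℤ) b c → z * 𝟙 (b ∧ c) ≡ z * 𝟙 c * 𝟙 b
𝟙-∧ z true c = sym (ℤP.*-identityʳ _)
𝟙-∧ z false c = trans (ℤP.*-zeroʳ z) (sym (ℤP.*-zeroʳ (z * 𝟙 c)))

sumTo-*𝟙-∸ : ∀ k x (g : ℕ → ℤ) → sumTo k (λ j → g j * 𝟙 ⌊ x ≟ k ∸ j ⌋) ≡ when ⌊ x ≤? k ⌋ (g (k ∸ x))
sumTo-*𝟙-∸ k x g with x ≤? k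
... | yes x≤k = begin
  sumTo k (λ j → g j * 𝟙 ⌊ x ≟ k ∸ j ⌋) ≡⟨ sumTo-single k (k ∸ x) _ (ℕP.m∸n≤m k x) others≡0 ⟩
  g (k ∸ x) * 𝟙 ⌊ x ≟ k ∸ (k ∸ x) ⌋    ≡⟨ cong (λ b → g (k ∸ x) * 𝟙 b)
                                             (isYes-true (x ≟ _) (sym (ℕP.m∸[m∸n]≡n x≤k))) ⟩
  g (k ∸ x) * + 1                       ≡⟨ ℤP.*-identityʳ _ ⟩
  g (k ∸ x)                             ∎
  where
  others≡0 : ∀ j → j ≤ k → j ≢ k ∸ x → g j * 𝟙 ⌊ x ≟ k ∸ j ⌋ ≡ + 0
  others≡0 j j≤k j≢k∸x
    rewrite isYes-false (x ≟ k ∸ j)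
              (λ x≡k∸j → j≢k∸x (trans (sym (ℕP.m∸[m∸n]≡n j≤k)) (cong (k ∸_) (sym x≡k∸j))))
    = ℤP.*-zeroʳ (g j)
... | no x≰k = sumTo-zero k all≡0
  where
  all≡0 : ∀ j → j ≤ k → g j * 𝟙 ⌊ x ≟ k ∸ j ⌋ ≡ + 0
  all≡0 j _ rewrite isYes-false (x ≟ k ∸ j) (λ x≡k∸j → x≰k (subst (_≤ k) (sym x≡k∸j) (ℕP.m∸n≤m k j)))
    = ℤP.*-zeroʳ (g j)

⊛-geom : ∀ (f : Series) a m n k → (f ⊛ geom a (suc m)) n k ≡
  sumTo n (λ d → when ⌊ suc m *ℕ d ≤? n ⌋ (when ⌊ a *ℕ d ≤? k ⌋ (f (n ∸ suc m *ℕ d) (k ∸ a *ℕ d))))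
⊛-geom f a m n k = begin
  sumTo n (λ i → sumTo k (λ j → f i j * sumTo (n ∸ i) (hit i j)))
    ≡⟨ sumTo-cong n (λ i _ → sumTo-cong k (λ j _ →
         cong (f i j *_) (sumTo-extend n (hit i j) (ℕP.m∸n≤m n i) (λ d n∸i<d _ → miss i j d n∸i<d)))) ⟩
  sumTo n (λ i → sumTo k (λ j → f i j * sumTo n (hit i j)))
    ≡⟨ sumTo-cong n (λ i _ → sumTo-cong k (λ j _ → sumTo-*ˡ n (f i j) (hit i j))) ⟩
  sumTo n (λ i → sumTo k (λ j → sumTo n (λ d → f i j * hit i j d)))
    ≡⟨ sumTo-cong n (λ i _ → sumTo-comm k n (λ j d → f i j * hit i j d)) ⟩
  sumTo n (λ i → sumTo n (λ d → sumTo k (λ j → f i j * hit i j d)))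
    ≡⟨ sumTo-comm n n (λ i d → sumTo k (λ j → f i j * hit i j d)) ⟩
  sumTo n (λ d → sumTo n (λ i → sumTo k (λ j → f i j * hit i j d)))
    ≡⟨ sumTo-cong n (λ d _ → collect d) ⟩
  sumTo n (λ d → when ⌊ suc m *ℕ d ≤? n ⌋ (when ⌊ a *ℕ d ≤? k ⌋ (f (n ∸ suc m *ℕ d) (k ∸ a *ℕ d)))) ∎
  where
  hit : ℕ → ℕ → ℕ → ℤ
  hit i j d = 𝟙 (⌊ suc m *ℕ d ≟ n ∸ i ⌋ ∧ ⌊ a *ℕ d ≟ k ∸ j ⌋)

  miss : ∀ i j d → n ∸ i < d → hit i j d ≡ + 0
  miss i j d n∸i<d rewrite isYes-false (suc m *ℕ d ≟ n ∸ i)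
    (λ eq → ℕP.<-irrefl refl (ℕP.<-≤-trans n∸i<d (subst (d ≤_) eq (ℕP.m≤n*m d (suc m))))) = refl

  collect : ∀ d → sumTo n (λ i → sumTo k (λ j → f i j * hit i j d)) ≡
    when ⌊ suc m *ℕ d ≤? n ⌋ (when ⌊ a *ℕ d ≤? k ⌋ (f (n ∸ suc m *ℕ d) (k ∸ a *ℕ d)))
  collect d = begin
    sumTo n (λ i → sumTo k (λ j → f i j * hit i j d))
      ≡⟨ sumTo-cong n (λ i _ → trans (sumTo-cong k (λ j _ → 𝟙-∧ (f i j) _ _)) (sym (sumTo-*ʳ k _ _))) ⟩
    sumTo n (λ i → sumTo k (λ j → f i j * 𝟙 ⌊ a *ℕ d ≟ k ∸ j ⌋) * 𝟙 ⌊ suc m *ℕ d ≟ n ∸ i ⌋)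
      ≡⟨ sumTo-*𝟙-∸ n (suc m *ℕ d) (λ i → sumTo k (λ j → f i j * 𝟙 ⌊ a *ℕ d ≟ k ∸ j ⌋)) ⟩
    when ⌊ suc m *ℕ d ≤? n ⌋ (sumTo k (λ j → f (n ∸ suc m *ℕ d) j * 𝟙 ⌊ a *ℕ d ≟ k ∸ j ⌋))
      ≡⟨ cong (when ⌊ suc m *ℕ d ≤? n ⌋) (sumTo-*𝟙-∸ k (a *ℕ d) (f (n ∸ suc m *ℕ d))) ⟩
    when ⌊ suc m *ℕ d ≤? n ⌋ (when ⌊ a *ℕ d ≤? k ⌋ (f (n ∸ suc m *ℕ d) (k ∸ a *ℕ d))) ∎

count : ∀ {A : Set} → (A → Bool) → List A → ℤ
count p [] = + 0
count p (x ∷ xs) = 𝟙 (p x) + count p xs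

module _ {A : Set} where

  count-++ : ∀ p (xs ys : List A) → count p (xs ++ ys) ≡ count p xs + count p ys
  count-++ p [] ys = sym (ℤP.+-identityˡ _)
  count-++ p (x ∷ xs) ys =
    trans (cong (_+_ (𝟙 (p x))) (count-++ p xs ys)) (sym (ℤP.+-assoc (𝟙 (p x)) _ _))

  count-map : ∀ {B : Set} p (g : B → A) xs → count p (map g xs) ≡ count (p ∘ g) xs
  count-map p g [] = refl
  count-map p g (x ∷ xs) = cong (_+_ (𝟙 (p (g x)))) (count-map p g xs)

  count-cong : ∀ {p q} (xs : List A) → (∀ x → x ∈ xs → p x ≡ q x) → count p xs ≡ count q xs
  count-cong [] _ = refl
  count-cong (x ∷ xs) p≡q =
    cong₂ (λ b c → 𝟙 b + c) (p≡q x (here refl)) (count-cong xs (λ y y∈xs → p≡q y (there y∈xs)))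

  count-∧ : ∀ b q (xs : List A) → count (λ x → b ∧ q x) xs ≡ when b (count q xs)
  count-∧ true q xs = refl
  count-∧ false q [] = refl
  count-∧ false q (x ∷ xs) = trans (ℤP.+-identityˡ _) (count-∧ false q xs)

  count-↭ : ∀ p {xs ys : List A} → xs ↭ ys → count p xs ≡ count p ys
  count-↭ p ↭.refl = refl
  count-↭ p (prep x xs↭ys) = cong (_+_ (𝟙 (p x))) (count-↭ p xs↭ys)
  count-↭ p {x ∷ y ∷ xs} {.y ∷ .x ∷ ys} (swap .x .y xs↭ys) = begin
    𝟙 (p x) + (𝟙 (p y) + count p xs) ≡⟨ sym (ℤP.+-assoc (𝟙 (p x)) _ _) ⟩
    𝟙 (p x) + 𝟙 (p y) + count p xs   ≡⟨ cong₂ _+_ (ℤP.+-comm (𝟙 (p x)) (𝟙 (p y))) (count-↭ p xs↭ys) ⟩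
    𝟙 (p y) + 𝟙 (p x) + count p ys   ≡⟨ ℤP.+-assoc (𝟙 (p y)) _ _ ⟩
    𝟙 (p y) + (𝟙 (p x) + count p ys) ∎
  count-↭ p (↭.trans xs↭ys ys↭zs) = trans (count-↭ p xs↭ys) (count-↭ p ys↭zs)

  count-unique : ∀ p {xs ys : List A} → Unique xs → Unique ys → (∀ z → (z ∈ xs) ⇔ (z ∈ ys)) →
    count p xs ≡ count p ys
  count-unique p xs! ys! xs⇔ys = count-↭ p (∼bag⇒↭ (unique∧set⇒bag xs! ys! (λ {z} → xs⇔ys z)))

weightedFrom : (ℕ → ℕ) → ℕ → List ℕ → ℕ
weightedFrom w i [] = 0
weightedFrom w i (d ∷ ds) = w i *ℕ d +ℕ weightedFrom w (suc i) ds

weightedFrom-∷ʳ : ∀ w i xs d → weightedFrom w i (xs ∷ʳ d) ≡ weightedFrom w i xs +ℕ w (i +ℕ length xs) *ℕ d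
weightedFrom-∷ʳ w i [] d = trans (ℕP.+-identityʳ (w i *ℕ d)) (cong (λ j → w j *ℕ d) (sym (ℕP.+-identityʳ i)))
weightedFrom-∷ʳ w i (x ∷ xs) d = begin
  w i *ℕ x +ℕ weightedFrom w (suc i) (xs ∷ʳ d)
    ≡⟨ cong (w i *ℕ x +ℕ_) (weightedFrom-∷ʳ w (suc i) xs d) ⟩
  w i *ℕ x +ℕ (weightedFrom w (suc i) xs +ℕ w (suc i +ℕ length xs) *ℕ d)
    ≡⟨ sym (ℕP.+-assoc (w i *ℕ x) _ _) ⟩
  weightedFrom w i (x ∷ xs) +ℕ w (suc i +ℕ length xs) *ℕ d
    ≡⟨ cong (λ j → weightedFrom w i (x ∷ xs) +ℕ w j *ℕ d) (sym (ℕP.+-suc i (length xs))) ⟩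
  weightedFrom w i (x ∷ xs) +ℕ w (i +ℕ length (x ∷ xs)) *ℕ d ∎

weightFrom-weightedFrom : ∀ i xs → weightFrom i xs ≡ weightedFrom id i xs
weightFrom-weightedFrom i [] = refl
weightFrom-weightedFrom i (x ∷ xs) = cong (i *ℕ x +ℕ_) (weightFrom-weightedFrom (suc i) xs)

weightFrom-∷ʳ : ∀ i xs d → weightFrom i (xs ∷ʳ d) ≡ weightFrom i xs +ℕ (i +ℕ length xs) *ℕ d
weightFrom-∷ʳ i xs d = begin
  weightFrom i (xs ∷ʳ d)
    ≡⟨ weightFrom-weightedFrom i (xs ∷ʳ d) ⟩
  weightedFrom id i (xs ∷ʳ d)
    ≡⟨ weightedFrom-∷ʳ id i xs d ⟩
  weightedFrom id i xs +ℕ (i +ℕ length xs) *ℕ d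
    ≡⟨ cong (_+ℕ (i +ℕ length xs) *ℕ d) (sym (weightFrom-weightedFrom i xs)) ⟩
  weightFrom i xs +ℕ (i +ℕ length xs) *ℕ d ∎

triWeight : List ℕ → ℕ
triWeight = weightedFrom tri 1

snocBlock : (ℕ → List (List ℕ)) → ℕ → ℕ → ℕ → List (List ℕ)
snocBlock vecs m n d = if ⌊ m *ℕ d ≤? n ⌋ then map (_∷ʳ d) (vecs (n ∸ m *ℕ d)) else []

snocBlocks : (ℕ → List (List ℕ)) → ℕ → ℕ → ℕ → List (List ℕ)
snocBlocks vecs m n zero = snocBlock vecs m n 0
snocBlocks vecs m n (suc c) = snocBlocks vecs m n c ++ snocBlock vecs m n (suc c)

-- The vectors (d₁, …, d_M) with Σ m d_m = n, enumerated according to their last entry d_M.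
multiplicities : ℕ → ℕ → List (List ℕ)
multiplicities zero n = if ⌊ n ≟ 0 ⌋ then [ [] ] else []
multiplicities (suc M) n = snocBlocks (multiplicities M) (suc M) n n

module _ (vecs : ℕ → List (List ℕ)) (m n : ℕ) where

  snocBlock-∈⁻ : ∀ d {x} → x ∈ snocBlock vecs m n d →
    m *ℕ d ≤ n × ∃ λ xs → xs ∈ vecs (n ∸ m *ℕ d) × x ≡ xs ∷ʳ d
  snocBlock-∈⁻ d x∈ with m *ℕ d ≤? n
  ... | yes md≤n = let (xs , xs∈ , x≡) = ∈-map⁻ (_∷ʳ d) x∈ in md≤n , xs , xs∈ , x≡
  ... | no _ with () ← x∈

  snocBlock-∈⁺ : ∀ d {xs} → m *ℕ d ≤ n → xs ∈ vecs (n ∸ m *ℕ d) → xs ∷ʳ d ∈ snocBlock vecs m n d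
  snocBlock-∈⁺ d md≤n xs∈ with m *ℕ d ≤? n
  ... | yes _ = ∈-map⁺ (_∷ʳ d) xs∈
  ... | no md≰n = ⊥-elim (md≰n md≤n)

  snocBlocks-∈⁻ : ∀ c {x} → x ∈ snocBlocks vecs m n c → ∃ λ d → d ≤ c × x ∈ snocBlock vecs m n d
  snocBlocks-∈⁻ zero x∈ = 0 , z≤n , x∈
  snocBlocks-∈⁻ (suc c) x∈ with ∈-++⁻ (snocBlocks vecs m n c) x∈
  ... | inj₁ x∈ˡ = let (d , d≤c , x∈d) = snocBlocks-∈⁻ c x∈ˡ in d , ℕP.m≤n⇒m≤1+n d≤c , x∈d
  ... | inj₂ x∈ʳ = suc c , ℕP.≤-refl , x∈ʳ

  snocBlocks-∈⁺ : ∀ c {d x} → d ≤ c → x ∈ snocBlock vecs m n d → x ∈ snocBlocks vecs m n c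
  snocBlocks-∈⁺ zero z≤n x∈ = x∈
  snocBlocks-∈⁺ (suc c) {d} d≤1+c x∈ with d ≤? c
  ... | yes d≤c = ∈-++⁺ˡ (snocBlocks-∈⁺ c d≤c x∈)
  ... | no d≰c rewrite ℕP.≤-antisym d≤1+c (ℕP.≰⇒> d≰c) = ∈-++⁺ʳ (snocBlocks vecs m n c) x∈

  snocBlock-last : ∀ d {xs e} → xs ∷ʳ e ∈ snocBlock vecs m n d → e ≡ d
  snocBlock-last d {xs} x∈ = let (_ , ys , _ , x≡) = snocBlock-∈⁻ d x∈ in List.∷ʳ-injectiveʳ xs ys x≡

  snocBlock-unique : (∀ n′ → Unique (vecs n′)) → ∀ d → Unique (snocBlock vecs m n d)
  snocBlock-unique vecs! d with m *ℕ d ≤? n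
  ... | yes _ = Unique.map⁺ (λ {xs} {ys} → List.∷ʳ-injectiveˡ xs ys) (vecs! _)
  ... | no _ = []

  snocBlocks-unique : (∀ n′ → Unique (vecs n′)) → ∀ c → Unique (snocBlocks vecs m n c)
  snocBlocks-unique vecs! zero = snocBlock-unique vecs! 0
  snocBlocks-unique vecs! (suc c) =
    Unique.++⁺ (snocBlocks-unique vecs! c) (snocBlock-unique vecs! (suc c)) disjoint
    where
    disjoint : ∀ {x} → ¬ (x ∈ snocBlocks vecs m n c × x ∈ snocBlock vecs m n (suc c))
    disjoint (x∈ˡ , x∈ʳ) with snocBlocks-∈⁻ c x∈ˡ | snocBlock-∈⁻ (suc c) x∈ʳ
    ... | d , d≤c , x∈d | _ , _ , _ , refl = ℕP.<-irrefl (sym (snocBlock-last d x∈d)) (s≤s d≤c)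

multiplicities-∈⁻ : ∀ M n {x} → x ∈ multiplicities M n → length x ≡ M × weightFrom 1 x ≡ n
multiplicities-∈⁻ zero n x∈ with n ≟ 0
multiplicities-∈⁻ zero n (here refl) | yes n≡0 = refl , sym n≡0
multiplicities-∈⁻ (suc M) n x∈ with snocBlocks-∈⁻ (multiplicities M) (suc M) n n x∈
... | d , _ , x∈d with snocBlock-∈⁻ (multiplicities M) (suc M) n d x∈d
... | Md≤n , xs , xs∈ , refl with multiplicities-∈⁻ M (n ∸ suc M *ℕ d) xs∈
... | length≡ , weight≡ = trans (List.length-++-comm xs [ d ]) (cong suc length≡) , (begin
  weightFrom 1 (xs ∷ʳ d)                        ≡⟨ weightFrom-∷ʳ 1 xs d ⟩
  weightFrom 1 xs +ℕ suc (length xs) *ℕ d       ≡⟨ cong₂ (λ w l → w +ℕ suc l *ℕ d) weight≡ length≡ ⟩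
  n ∸ suc M *ℕ d +ℕ suc M *ℕ d                  ≡⟨ ℕP.m∸n+n≡m Md≤n ⟩
  n                                             ∎)

multiplicities-∈⁺ : ∀ M n {x} → length x ≡ M → weightFrom 1 x ≡ n → x ∈ multiplicities M n
multiplicities-∈⁺ zero n {[]} refl refl = here refl
multiplicities-∈⁺ (suc M) n {x} length≡ weight≡ with initLast x
... | xs ∷ʳ′ d = snocBlocks-∈⁺ (multiplicities M) (suc M) n n d≤n
  (snocBlock-∈⁺ (multiplicities M) (suc M) n d Md≤n
    (multiplicities-∈⁺ M (n ∸ suc M *ℕ d) length-xs weight-xs))
  where
  length-xs : length xs ≡ M
  length-xs = ℕP.suc-injective (trans (sym (List.length-++-comm xs [ d ])) length≡)
  weight≡′ : weightFrom 1 xs +ℕ suc M *ℕ d ≡ n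
  weight≡′ = trans (cong (λ l → weightFrom 1 xs +ℕ suc l *ℕ d) (sym length-xs))
                   (trans (sym (weightFrom-∷ʳ 1 xs d)) weight≡)
  weight-xs : weightFrom 1 xs ≡ n ∸ suc M *ℕ d
  weight-xs = trans (sym (ℕP.m+n∸n≡m (weightFrom 1 xs) (suc M *ℕ d))) (cong (_∸ suc M *ℕ d) weight≡′)
  Md≤n : suc M *ℕ d ≤ n
  Md≤n = subst (suc M *ℕ d ≤_) weight≡′ (ℕP.m≤n+m (suc M *ℕ d) (weightFrom 1 xs))
  d≤n : d ≤ n
  d≤n = ℕP.≤-trans (ℕP.m≤n*m d (suc M)) Md≤n

multiplicities-unique : ∀ M n → Unique (multiplicities M n)
multiplicities-unique zero n with n ≟ 0
... | yes _ = [] ∷ []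
... | no _ = []
multiplicities-unique (suc M) n = snocBlocks-unique (multiplicities M) (suc M) n (multiplicities-unique M) n

count-snocBlocks : ∀ p vecs m n c →
  count p (snocBlocks vecs m n c) ≡ sumTo c (λ d → count p (snocBlock vecs m n d))
count-snocBlocks p vecs m n zero = refl
count-snocBlocks p vecs m n (suc c) = trans (count-++ p (snocBlocks vecs m n c) _)
  (cong (_+ count p (snocBlock vecs m n (suc c))) (count-snocBlocks p vecs m n c))

hasTriWeight : ℕ → List ℕ → Bool
hasTriWeight k ds = ⌊ triWeight ds ≟ k ⌋

snocBlock-count : ∀ M n k d →
  count (hasTriWeight k) (snocBlock (multiplicities M) (suc M) n d) ≡
  when ⌊ suc M *ℕ d ≤? n ⌋ (when ⌊ tri (suc M) *ℕ d ≤? k ⌋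
    (count (hasTriWeight (k ∸ tri (suc M) *ℕ d)) (multiplicities M (n ∸ suc M *ℕ d))))
snocBlock-count M n k d with suc M *ℕ d ≤? n
... | no _ = refl
... | yes _ = begin
  count (hasTriWeight k) (map (_∷ʳ d) vecs)
    ≡⟨ count-map (hasTriWeight k) (_∷ʳ d) vecs ⟩
  count (hasTriWeight k ∘ (_∷ʳ d)) vecs
    ≡⟨ count-cong vecs (λ xs xs∈ → trans (cong (λ w → ⌊ w ≟ k ⌋) (triWeight-∷ʳ xs xs∈))
                                          (+-≟-split (triWeight xs) (tri (suc M) *ℕ d) k)) ⟩
  count (λ xs → ⌊ tri (suc M) *ℕ d ≤? k ⌋ ∧ hasTriWeight (k ∸ tri (suc M) *ℕ d) xs) vecs
    ≡⟨ count-∧ ⌊ tri (suc M) *ℕ d ≤? k ⌋ (hasTriWeight (k ∸ tri (suc M) *ℕ d)) vecs ⟩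
  when ⌊ tri (suc M) *ℕ d ≤? k ⌋ (count (hasTriWeight (k ∸ tri (suc M) *ℕ d)) vecs) ∎
  where
  vecs : List (List ℕ)
  vecs = multiplicities M (n ∸ suc M *ℕ d)
  triWeight-∷ʳ : ∀ xs → xs ∈ vecs → triWeight (xs ∷ʳ d) ≡ triWeight xs +ℕ tri (suc M) *ℕ d
  triWeight-∷ʳ xs xs∈ = trans (weightedFrom-∷ʳ tri 1 xs d)
    (cong (λ l → triWeight xs +ℕ tri (suc l) *ℕ d) (proj₁ (multiplicities-∈⁻ M _ xs∈)))

finProd-count-multiplicities : ∀ M n k → finProd M n k ≡ count (hasTriWeight k) (multiplicities M n)
finProd-count-multiplicities zero zero zero = refl
finProd-count-multiplicities zero zero (suc k) = refl
finProd-count-multiplicities zero (suc n) k = refl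
finProd-count-multiplicities (suc M) n k = begin
  (finProd M ⊛ factor (suc M)) n k
    ≡⟨ ⊛-geom (finProd M) (tri (suc M)) M n k ⟩
  sumTo n (λ d → when ⌊ suc M *ℕ d ≤? n ⌋ (when ⌊ tri (suc M) *ℕ d ≤? k ⌋
    (finProd M (n ∸ suc M *ℕ d) (k ∸ tri (suc M) *ℕ d))))
    ≡⟨ sumTo-cong n (λ d _ → cong (when ⌊ suc M *ℕ d ≤? n ⌋ ∘ when ⌊ tri (suc M) *ℕ d ≤? k ⌋)
                                  (finProd-count-multiplicities M (n ∸ suc M *ℕ d) (k ∸ tri (suc M) *ℕ d))) ⟩
  sumTo n (λ d → when ⌊ suc M *ℕ d ≤? n ⌋ (when ⌊ tri (suc M) *ℕ d ≤? k ⌋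
    (count (hasTriWeight (k ∸ tri (suc M) *ℕ d)) (multiplicities M (n ∸ suc M *ℕ d)))))
    ≡⟨ sumTo-cong n (λ d _ → sym (snocBlock-count M n k d)) ⟩
  sumTo n (λ d → count (hasTriWeight k) (snocBlock (multiplicities M) (suc M) n d))
    ≡⟨ sym (count-snocBlocks (hasTriWeight k) (multiplicities M) (suc M) n n) ⟩
  count (hasTriWeight k) (multiplicities (suc M) n) ∎

head₀ : List ℕ → ℕ
head₀ [] = 0
head₀ (p ∷ _) = p

consDiff : ℕ → List ℕ → List ℕ
consDiff d (p ∷ ps) = d +ℕ p ∷ p ∷ ps
consDiff zero [] = []
consDiff (suc d) [] = suc d ∷ []

-- fromDiffs (d₁, …, d_M) has parts μ_j = d_j + ⋯ + d_M, with trailing zero parts omitted.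
fromDiffs : List ℕ → List ℕ
fromDiffs = foldr consDiff []

diffs : ℕ → List ℕ → List ℕ
diffs zero _ = []
diffs (suc M) μ = head₀ μ ∸ head₀ (drop 1 μ) ∷ diffs M (drop 1 μ)

consDiff-invariant : ∀ {A : Set} (F : List ℕ → A) → F [] ≡ F [ 0 ] →
  ∀ d ν → F (consDiff d ν) ≡ F (d +ℕ head₀ ν ∷ ν)
consDiff-invariant F F[0] d (p ∷ ps) = refl
consDiff-invariant F F[0] zero [] = F[0]
consDiff-invariant F F[0] (suc d) [] = cong (λ p → F [ p ]) (sym (ℕP.+-identityʳ (suc d)))

tri-suc : ∀ i → tri (suc i) ≡ suc i +ℕ tri i
tri-suc i = trans (sym (nCk+nC[k+1]≡[n+1]C[k+1] (suc i) 1)) (cong (_+ℕ tri i) (nC1≡n (suc i)))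

weightFrom-suc : ∀ i xs → weightFrom (suc i) xs ≡ weightFrom i xs +ℕ sum xs
weightFrom-suc i [] = refl
weightFrom-suc i (x ∷ xs) =
  trans (cong (x +ℕ i *ℕ x +ℕ_) (weightFrom-suc (suc i) xs)) (shuffle (i *ℕ x) x _ _)
  where
  shuffle : ∀ a x w s → (x +ℕ a) +ℕ (w +ℕ s) ≡ (a +ℕ w) +ℕ (x +ℕ s)
  shuffle = solve-∀

weightedFrom-tri-suc : ∀ i xs → weightedFrom tri (suc i) xs ≡ weightedFrom tri i xs +ℕ weightFrom (suc i) xs
weightedFrom-tri-suc i [] = refl
weightedFrom-tri-suc i (x ∷ xs) =
  trans (cong₂ (λ t w → t *ℕ x +ℕ w) (tri-suc i) (weightedFrom-tri-suc (suc i) xs))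
        (shuffle (suc i) (tri i) x _ _)
  where
  shuffle : ∀ a b x w u → (a +ℕ b) *ℕ x +ℕ (w +ℕ u) ≡ (b *ℕ x +ℕ w) +ℕ (a *ℕ x +ℕ u)
  shuffle = solve-∀

head₀-fromDiffs : ∀ ds → head₀ (fromDiffs ds) ≡ sum ds
head₀-fromDiffs [] = refl
head₀-fromDiffs (d ∷ ds) =
  trans (consDiff-invariant head₀ refl d (fromDiffs ds)) (cong (d +ℕ_) (head₀-fromDiffs ds))

sum-fromDiffs : ∀ ds → sum (fromDiffs ds) ≡ weightFrom 1 ds
sum-fromDiffs [] = refl
sum-fromDiffs (d ∷ ds) = begin
  sum (consDiff d (fromDiffs ds))
    ≡⟨ consDiff-invariant sum refl d (fromDiffs ds) ⟩
  d +ℕ head₀ (fromDiffs ds) +ℕ sum (fromDiffs ds)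
    ≡⟨ cong₂ (λ h s → d +ℕ h +ℕ s) (head₀-fromDiffs ds) (sum-fromDiffs ds) ⟩
  d +ℕ sum ds +ℕ weightFrom 1 ds
    ≡⟨ shuffle d (sum ds) (weightFrom 1 ds) ⟩
  1 *ℕ d +ℕ (weightFrom 1 ds +ℕ sum ds)
    ≡⟨ cong (1 *ℕ d +ℕ_) (sym (weightFrom-suc 1 ds)) ⟩
  weightFrom 1 (d ∷ ds) ∎
  where
  shuffle : ∀ d s w → d +ℕ s +ℕ w ≡ 1 *ℕ d +ℕ (w +ℕ s)
  shuffle = solve-∀

weightFrom-fromDiffs : ∀ ds → weightFrom 1 (fromDiffs ds) ≡ triWeight ds
weightFrom-fromDiffs [] = refl
weightFrom-fromDiffs (d ∷ ds) = begin
  weightFrom 1 (consDiff d μ)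
    ≡⟨ consDiff-invariant (weightFrom 1) refl d μ ⟩
  1 *ℕ (d +ℕ head₀ μ) +ℕ weightFrom 2 μ
    ≡⟨ cong₂ (λ h w → 1 *ℕ (d +ℕ h) +ℕ w) (head₀-fromDiffs ds) (weightFrom-suc 1 μ) ⟩
  1 *ℕ (d +ℕ sum ds) +ℕ (weightFrom 1 μ +ℕ sum μ)
    ≡⟨ cong₂ (λ w s → 1 *ℕ (d +ℕ sum ds) +ℕ (w +ℕ s)) (weightFrom-fromDiffs ds) (sum-fromDiffs ds) ⟩
  1 *ℕ (d +ℕ sum ds) +ℕ (triWeight ds +ℕ weightFrom 1 ds)
    ≡⟨ shuffle d (sum ds) (weightFrom 1 ds) (triWeight ds) ⟩
  1 *ℕ d +ℕ (triWeight ds +ℕ (weightFrom 1 ds +ℕ sum ds))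
    ≡⟨ cong (λ w → 1 *ℕ d +ℕ (triWeight ds +ℕ w)) (sym (weightFrom-suc 1 ds)) ⟩
  1 *ℕ d +ℕ (triWeight ds +ℕ weightFrom 2 ds)
    ≡⟨ cong (1 *ℕ d +ℕ_) (sym (weightedFrom-tri-suc 1 ds)) ⟩
  triWeight (d ∷ ds) ∎
  where
  μ : List ℕ
  μ = fromDiffs ds
  shuffle : ∀ d s w t → 1 *ℕ (d +ℕ s) +ℕ (t +ℕ w) ≡ 1 *ℕ d +ℕ (t +ℕ (w +ℕ s))
  shuffle = solve-∀

fromDiffs-positive : ∀ ds → All (λ p → 1 ≤ p) (fromDiffs ds)
fromDiffs-positive [] = []
fromDiffs-positive (d ∷ ds) = consDiff-positive d (fromDiffs ds) (fromDiffs-positive ds)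
  where
  consDiff-positive : ∀ d ν → All (λ p → 1 ≤ p) ν → All (λ p → 1 ≤ p) (consDiff d ν)
  consDiff-positive d (p ∷ ps) (1≤p ∷ ps⁺) = ℕP.≤-trans 1≤p (ℕP.m≤n+m p d) ∷ 1≤p ∷ ps⁺
  consDiff-positive zero [] [] = []
  consDiff-positive (suc d) [] [] = s≤s z≤n ∷ []

fromDiffs-nonincreasing : ∀ ds → Linked _≥_ (fromDiffs ds)
fromDiffs-nonincreasing [] = []
fromDiffs-nonincreasing (d ∷ ds) = consDiff-nonincreasing d (fromDiffs ds) (fromDiffs-nonincreasing ds)
  where
  consDiff-nonincreasing : ∀ d ν → Linked _≥_ ν → Linked _≥_ (consDiff d ν)
  consDiff-nonincreasing d (p ∷ ps) ν↓ = ℕP.m≤n+m p d ∷ ν↓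
  consDiff-nonincreasing zero [] [] = []
  consDiff-nonincreasing (suc d) [] [] = [-]

length-diffs : ∀ M μ → length (diffs M μ) ≡ M
length-diffs zero μ = refl
length-diffs (suc M) μ = cong suc (length-diffs M (drop 1 μ))

diffs-fromDiffs : ∀ ds → diffs (length ds) (fromDiffs ds) ≡ ds
diffs-fromDiffs [] = refl
diffs-fromDiffs (d ∷ ds)
  rewrite consDiff-invariant (drop 1) refl d (fromDiffs ds)
        | consDiff-invariant head₀ refl d (fromDiffs ds)
        | diffs-fromDiffs ds
  = cong (_∷ ds) (ℕP.m+n∸n≡m d (head₀ (fromDiffs ds)))

fromDiffs-diffs : ∀ M μ → All (λ p → 1 ≤ p) μ → Linked _≥_ μ → length μ ≤ M → fromDiffs (diffs M μ) ≡ μ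
fromDiffs-diffs zero [] _ _ _ = refl
fromDiffs-diffs (suc M) [] _ _ _ rewrite fromDiffs-diffs M [] [] [] z≤n = refl
fromDiffs-diffs (suc M) (p ∷ ps) (1≤p ∷ ps⁺) μ↓ (s≤s length≤M)
  rewrite fromDiffs-diffs M ps ps⁺ (Linked.tail μ↓) length≤M with ps | μ↓ | 1≤p
... | [] | _ | s≤s _ = refl
... | q ∷ qs | q≤p ∷ _ | _ = cong (_∷ q ∷ qs) (ℕP.m∸n+n≡m q≤p)

length≤sum : ∀ μ → All (λ p → 1 ≤ p) μ → length μ ≤ sum μ
length≤sum [] [] = z≤n
length≤sum (p ∷ ps) (1≤p ∷ ps⁺) = ℕP.+-mono-≤ 1≤p (length≤sum ps ps⁺)

partitions : ℕ → ℕ → List (List ℕ)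
partitions M n = map fromDiffs (multiplicities M n)

∈-partitions : ∀ {M n} → n ≤ M → ∀ μ → (μ ∈ partitions M n) ⇔ IsPartition n μ
∈-partitions {M} {n} n≤M μ = mk⇔ to from
  where
  to : μ ∈ partitions M n → IsPartition n μ
  to μ∈ with ∈-map⁻ fromDiffs μ∈
  ... | ds , ds∈ , refl = fromDiffs-positive ds , fromDiffs-nonincreasing ds ,
                          trans (sum-fromDiffs ds) (proj₂ (multiplicities-∈⁻ M n ds∈))
  from : IsPartition n μ → μ ∈ partitions M n
  from (μ⁺ , μ↓ , sum≡n) = subst (_∈ partitions M n) fromDiffs-diffs-μ
    (∈-map⁺ fromDiffs (multiplicities-∈⁺ M n {diffs M μ} (length-diffs M μ) weight≡n))
    where
    fromDiffs-diffs-μ : fromDiffs (diffs M μ) ≡ μ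
    fromDiffs-diffs-μ =
      fromDiffs-diffs M μ μ⁺ μ↓ (ℕP.≤-trans (length≤sum μ μ⁺) (subst (_≤ M) (sym sum≡n) n≤M))
    weight≡n : weightFrom 1 (diffs M μ) ≡ n
    weight≡n = trans (sym (sum-fromDiffs (diffs M μ))) (trans (cong sum fromDiffs-diffs-μ) sum≡n)

-- fromDiffs itself is not injective (it drops trailing zeros), but diffs M undoes it on vectors of length M.
partitions-unique : ∀ M n → Unique (partitions M n)
partitions-unique M n = Unique.map⁻ (subst Unique (sym diffs∘fromDiffs≡id) (multiplicities-unique M n))
  where
  diffs∘fromDiffs≡id : map (diffs M) (partitions M n) ≡ multiplicities M n
  diffs∘fromDiffs≡id = trans (sym (List.map-∘ (multiplicities M n))) (List.map-id-local (All.tabulate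
    (λ {ds} ds∈ → subst (λ l → diffs l (fromDiffs ds) ≡ ds)
                        (proj₁ (multiplicities-∈⁻ M n ds∈)) (diffs-fromDiffs ds))))

hasWeight : ℕ → List ℕ → Bool
hasWeight k μ = ⌊ weightFrom 1 μ ≟ k ⌋

finProd-count-partitions : ∀ M n k → finProd M n k ≡ count (hasWeight k) (partitions M n)
finProd-count-partitions M n k = begin
  finProd M n k
    ≡⟨ finProd-count-multiplicities M n k ⟩
  count (hasTriWeight k) (multiplicities M n)
    ≡⟨ count-cong (multiplicities M n) (λ ds _ → cong (λ w → ⌊ w ≟ k ⌋) (sym (weightFrom-fromDiffs ds))) ⟩
  count (hasWeight k ∘ fromDiffs) (multiplicities M n)
    ≡⟨ count-map (hasWeight k) fromDiffs (multiplicities M n) ⟨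
  count (hasWeight k) (partitions M n) ∎

finProd-count-stable : ∀ M k {n L} → n ≤ M → Unique L → (∀ μ → (μ ∈ L) ⇔ IsPartition n μ) →
  finProd M n k ≡ count (hasWeight k) L
finProd-count-stable M k {n} n≤M L! L⇔ = trans (finProd-count-partitions M n k)
  (count-unique (hasWeight k) (partitions-unique M n) L!
    (λ μ → mk⇔ (Equivalence.from (L⇔ μ) ∘ Equivalence.to (∈-partitions n≤M μ))
               (Equivalence.from (∈-partitions n≤M μ) ∘ Equivalence.to (L⇔ μ))))

IsPartition-0 : ∀ μ → IsPartition 0 μ → μ ≡ []
IsPartition-0 [] _ = refl
IsPartition-0 (zero ∷ _) (() ∷ _ , _)
IsPartition-0 (suc _ ∷ _) (_ , _ , ())

finProd-constant : ∀ M k → finProd M 0 k ≡ one 0 k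
finProd-constant M k = trans (finProd-count-stable M k z≤n ([] ∷ []) partitions-of-0) (count-[[]] k)
  where
  partitions-of-0 : ∀ μ → (μ ∈ [ [] ]) ⇔ IsPartition 0 μ
  partitions-of-0 μ = mk⇔ (λ { (here refl) → [] , [] , refl }) (λ μ⁰ → here (IsPartition-0 μ μ⁰))
  count-[[]] : ∀ k → count (hasWeight k) [ [] ] ≡ one 0 k
  count-[[]] zero = refl
  count-[[]] (suc k) = refl

rhsCoeff-count : ∀ n k L → rhsCoeff (suc n) k L ≡ count (hasWeight k) L
rhsCoeff-count n k [] = refl
rhsCoeff-count n k (μ ∷ L) = cong₂ (λ b c → 𝟙 b + c) exponent≡weight (rhsCoeff-count n k L)
  where
  m-[m-n]≡n : ∀ (t w : ℤ) → t - (t - w) ≡ w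
  m-[m-n]≡n = ℤSolver.solve-∀
  exponent≡weight : ⌊ + k ℤP.≟ + tri (suc n) - gini (suc n) μ ⌋ ≡ hasWeight k μ
  exponent≡weight rewrite m-[m-n]≡n (+ tri (suc n)) (+ weightFrom 1 μ) =
    isYes-⇔ (+ k ℤP.≟ + weightFrom 1 μ) (weightFrom 1 μ ≟ k) (sym ∘ ℤP.+-injective) (cong +_ ∘ sym)

proposition3 : (n k : ℕ) (L : List (List ℕ)) → Unique L →
    ((μ : List ℕ) → (μ ∈ L) ⇔ IsPartition n μ) →
    ∃ λ M → (M′ : ℕ) → M ≤ M′ → finProd M′ n k - one n k ≡ rhsCoeff n k L
proposition3 zero k L _ _ = 0 , λ M _ → begin
  finProd M 0 k - one 0 k  ≡⟨ cong (_- one 0 k) (finProd-constant M k) ⟩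
  one 0 k - one 0 k        ≡⟨ ℤP.+-inverseʳ (one 0 k) ⟩
  + 0                      ∎
proposition3 (suc n) k L L! L⇔ = suc n , λ M n<M → begin
  finProd M (suc n) k - + 0  ≡⟨ ℤP.+-identityʳ _ ⟩
  finProd M (suc n) k        ≡⟨ finProd-count-stable M k n<M L! L⇔ ⟩
  count (hasWeight k) L      ≡⟨ rhsCoeff-count n k L ⟨
  rhsCoeff (suc n) k L       ∎
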